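{- Let $G$ be a group, $p$ a prime, and $g,a,x,y\in G$ with $g\in\eta(a)$ and $x^p=a$. If $g\notin\eta(y)$, then $y\in\eta(x)$.
   Context: For $g\in G$, $\eta(g)=\{h\in G: g\notin\langle h\rangle\}$, i.e. the set of $h\in G$ such that $h^n=g$ has no solution $n\in\mathbb{Z}$. -}

module Defs where


open import Algebra.Bundles using (Group)
open import Data.Nat using (ℕ; zero; suc)
open import Data.Integer using (ℤ; +_; -[1+_])
open import Data.Product using (∃)
open import Relation.Nullary using (¬_)

module GroupDefs {c ℓ} (G : Group c ℓ) where
  open Group G

  _^ℕ_ : Carrier → ℕ → Carrier
  h ^ℕ zero  = ε
  h ^ℕ suc n = h ∙ (h ^ℕ n)

  _^ℤ_ : Carrier → ℤ → Carrier
  h ^ℤ (+ n)     = h ^ℕ n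
  h ^ℤ -[1+ n ]  = (h ^ℕ suc n) ⁻¹

  _∈⟨_⟩ : Carrier → Carrier → Set ℓ
  g ∈⟨ h ⟩ = ∃ λ (n : ℤ) → h ^ℤ n ≈ g

  _∈η_ : Carrier → Carrier → Set ℓ
  h ∈η g = ¬ (g ∈⟨ h ⟩)

module Submission where

-- The argument:
-- if x ∈ ⟨y⟩ and y ∈ ⟨g⟩, then x ∈ ⟨g⟩ because a cyclic subgroup contains all
-- integer powers of its elements; hence a ≈ xᵖ ∈ ⟨g⟩, a contradiction.  Since
-- the goal is a negation, the double-negated hypothesis y ∈ ⟨g⟩ may be used
-- directly.

open import Defs
open import Algebra.Bundles using (Group)
open import Data.Nat using (ℕ; zero; suc)
open import Data.Nat.Primality using (Prime)
open import Data.Integer using (+_; -[1+_])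
open import Data.Product using (_,_)
open import Relation.Nullary using (¬_)

module CyclicSubgroup {c ℓ} (G : Group c ℓ) where
  open Group G
  open GroupDefs G
  open import Algebra.Properties.Group G using (ε⁻¹≈ε; ⁻¹-involutive; ⁻¹-anti-homo-∙)
  open import Relation.Binary.Reasoning.Setoid setoid

  module _ (g : Carrier) where

    ∈⟨⟩-resp-≈ : ∀ {u v} → u ≈ v → u ∈⟨ g ⟩ → v ∈⟨ g ⟩
    ∈⟨⟩-resp-≈ u≈v (n , gⁿ≈u) = n , trans gⁿ≈u u≈v

    ^ℕ-comm : ∀ n → g ∙ (g ^ℕ n) ≈ (g ^ℕ n) ∙ g
    ^ℕ-comm zero    = trans (identityʳ g) (sym (identityˡ g))
    ^ℕ-comm (suc n) = trans (∙-congˡ (^ℕ-comm n)) (sym (assoc g (g ^ℕ n) g))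

    g∙-closed : ∀ {h} → h ∈⟨ g ⟩ → (g ∙ h) ∈⟨ g ⟩
    g∙-closed (+ n , gⁿ≈h) = + suc n , ∙-congˡ gⁿ≈h
    g∙-closed {h} (-[1+ zero ] , g⁻¹≈h) = + zero , sym (begin
      g ∙ h             ≈⟨ ∙-congˡ (sym g⁻¹≈h) ⟩
      g ∙ (g ∙ ε) ⁻¹    ≈⟨ ∙-congˡ (⁻¹-cong (identityʳ g)) ⟩
      g ∙ g ⁻¹          ≈⟨ inverseʳ g ⟩
      ε                 ∎)
    g∙-closed {h} (-[1+ suc k ] , g⁻ᵏ⁻²≈h) = -[1+ k ] , sym (begin
      g ∙ h                             ≈⟨ ∙-congˡ (sym g⁻ᵏ⁻²≈h) ⟩
      g ∙ (g ∙ gᵏ⁺¹) ⁻¹                 ≈⟨ ∙-congˡ (⁻¹-cong (^ℕ-comm (suc k))) ⟩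
      g ∙ (gᵏ⁺¹ ∙ g) ⁻¹                 ≈⟨ ∙-congˡ (⁻¹-anti-homo-∙ gᵏ⁺¹ g) ⟩
      g ∙ (g ⁻¹ ∙ gᵏ⁺¹ ⁻¹)              ≈⟨ sym (assoc g (g ⁻¹) (gᵏ⁺¹ ⁻¹)) ⟩
      (g ∙ g ⁻¹) ∙ gᵏ⁺¹ ⁻¹              ≈⟨ ∙-congʳ (inverseʳ g) ⟩
      ε ∙ gᵏ⁺¹ ⁻¹                       ≈⟨ identityˡ (gᵏ⁺¹ ⁻¹) ⟩
      gᵏ⁺¹ ⁻¹                           ∎)
      where gᵏ⁺¹ = g ^ℕ suc k

    g⁻¹∙-closed : ∀ {h} → h ∈⟨ g ⟩ → (g ⁻¹ ∙ h) ∈⟨ g ⟩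
    g⁻¹∙-closed {h} (+ zero , ε≈h) = -[1+ zero ] , (begin
      (g ∙ ε) ⁻¹        ≈⟨ ⁻¹-cong (identityʳ g) ⟩
      g ⁻¹              ≈⟨ sym (identityʳ (g ⁻¹)) ⟩
      g ⁻¹ ∙ ε          ≈⟨ ∙-congˡ ε≈h ⟩
      g ⁻¹ ∙ h          ∎)
    g⁻¹∙-closed {h} (+ suc n , gⁿ⁺¹≈h) = + n , sym (begin
      g ⁻¹ ∙ h              ≈⟨ ∙-congˡ (sym gⁿ⁺¹≈h) ⟩
      g ⁻¹ ∙ (g ∙ g ^ℕ n)   ≈⟨ sym (assoc (g ⁻¹) g (g ^ℕ n)) ⟩
      (g ⁻¹ ∙ g) ∙ g ^ℕ n   ≈⟨ ∙-congʳ (inverseˡ g) ⟩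
      ε ∙ g ^ℕ n            ≈⟨ identityˡ (g ^ℕ n) ⟩
      g ^ℕ n                ∎)
    g⁻¹∙-closed {h} (-[1+ n ] , g⁻ⁿ⁻¹≈h) = -[1+ suc n ] , (begin
      (g ∙ gⁿ⁺¹) ⁻¹         ≈⟨ ⁻¹-cong (^ℕ-comm (suc n)) ⟩
      (gⁿ⁺¹ ∙ g) ⁻¹         ≈⟨ ⁻¹-anti-homo-∙ gⁿ⁺¹ g ⟩
      g ⁻¹ ∙ gⁿ⁺¹ ⁻¹        ≈⟨ ∙-congˡ g⁻ⁿ⁻¹≈h ⟩
      g ⁻¹ ∙ h              ∎)
      where gⁿ⁺¹ = g ^ℕ suc n

    ^ℕ∙-closed : ∀ n {h} → h ∈⟨ g ⟩ → ((g ^ℕ n) ∙ h) ∈⟨ g ⟩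
    ^ℕ∙-closed zero    h∈ = ∈⟨⟩-resp-≈ (sym (identityˡ _)) h∈
    ^ℕ∙-closed (suc n) h∈ = ∈⟨⟩-resp-≈ (sym (assoc _ _ _)) (g∙-closed (^ℕ∙-closed n h∈))

    ^ℕ⁻¹∙-closed : ∀ n {h} → h ∈⟨ g ⟩ → ((g ^ℕ n) ⁻¹ ∙ h) ∈⟨ g ⟩
    ^ℕ⁻¹∙-closed zero    h∈ =
      ∈⟨⟩-resp-≈ (sym (trans (∙-congʳ ε⁻¹≈ε) (identityˡ _))) h∈
    ^ℕ⁻¹∙-closed (suc n) h∈ =
      ∈⟨⟩-resp-≈ (sym (trans (∙-congʳ (⁻¹-anti-homo-∙ _ _)) (assoc _ _ _)))
                 (^ℕ⁻¹∙-closed n (g⁻¹∙-closed h∈))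

    ε-closed : ε ∈⟨ g ⟩
    ε-closed = + zero , refl

    ∙-closed : ∀ {u h} → u ∈⟨ g ⟩ → h ∈⟨ g ⟩ → (u ∙ h) ∈⟨ g ⟩
    ∙-closed (+ n ,     gⁿ≈u) h∈ = ∈⟨⟩-resp-≈ (∙-congʳ gⁿ≈u) (^ℕ∙-closed n h∈)
    ∙-closed (-[1+ n ] , gⁿ≈u) h∈ = ∈⟨⟩-resp-≈ (∙-congʳ gⁿ≈u) (^ℕ⁻¹∙-closed (suc n) h∈)

    ⁻¹-closed : ∀ {u} → u ∈⟨ g ⟩ → (u ⁻¹) ∈⟨ g ⟩
    ⁻¹-closed (+ zero ,   ε≈u)    = + zero , trans (sym ε⁻¹≈ε) (⁻¹-cong ε≈u)
    ⁻¹-closed (+ suc n ,  gⁿ⁺¹≈u) = -[1+ n ] , ⁻¹-cong gⁿ⁺¹≈u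
    ⁻¹-closed (-[1+ n ] , g⁻ⁿ⁻¹≈u) =
      + suc n , trans (sym (⁻¹-involutive _)) (⁻¹-cong g⁻ⁿ⁻¹≈u)

    ^ℕ-closed : ∀ {h} → h ∈⟨ g ⟩ → ∀ n → (h ^ℕ n) ∈⟨ g ⟩
    ^ℕ-closed h∈ zero    = ε-closed
    ^ℕ-closed h∈ (suc n) = ∙-closed h∈ (^ℕ-closed h∈ n)

    ^ℤ-closed : ∀ {h} → h ∈⟨ g ⟩ → ∀ z → (h ^ℤ z) ∈⟨ g ⟩
    ^ℤ-closed h∈ (+ n)    = ^ℕ-closed h∈ n
    ^ℤ-closed h∈ -[1+ n ] = ⁻¹-closed (^ℕ-closed h∈ (suc n))

  ∈⟨⟩-trans : ∀ {g y x} → y ∈⟨ g ⟩ → x ∈⟨ y ⟩ → x ∈⟨ g ⟩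
  ∈⟨⟩-trans {g} y∈⟨g⟩ (n , yⁿ≈x) = ∈⟨⟩-resp-≈ g yⁿ≈x (^ℤ-closed g y∈⟨g⟩ n)

lemma3p9 : ∀ {c ℓ} (G : Group c ℓ) (p : ℕ) → Prime p →
    (g a x y : Group.Carrier G) →
    GroupDefs._∈η_ G g a →
    Group._≈_ G (GroupDefs._^ℕ_ G x p) a →
    ¬ (GroupDefs._∈η_ G g y) →
    GroupDefs._∈η_ G y x
lemma3p9 G p _ g a x y a∉⟨g⟩ xᵖ≈a ¬¬y∈⟨g⟩ x∈⟨y⟩ = ¬¬y∈⟨g⟩ λ y∈⟨g⟩ →
  let x∈⟨g⟩ = ∈⟨⟩-trans y∈⟨g⟩ x∈⟨y⟩
  in a∉⟨g⟩ (∈⟨⟩-resp-≈ g xᵖ≈a (^ℕ-closed g x∈⟨g⟩ p))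
  where open CyclicSubgroup G
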